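{- For each integer $e \geq 1$, the set $F_e = \{n \in \mathbb{Z}^+ : n > 1 \text{ and } S_{e,!}(n) = n\}$ consists of pairs of consecutive integers (i.e., if $n\in F_e$ is odd then $n-1\in F_e$, and if $n\in F_e$ is even then $n+1\in F_e$).
   Context: Every positive integer $n$ has a unique factoradic (factorial base) representation $n=\sum_{i=1}^k a_i\cdot i!$ with $a_k\neq 0$ and $0\leq a_i\leq i$ for $1\leq i\leq k$. For an integer $e\geq 1$, the $e$-power factoradic happy function $S_{e,!}:\mathbb{Z}_{\geq 0}\to\mathbb{Z}_{\geq 0}$ is defined by $S_{e,!}(0)=0$ and $S_{e,!}(n)=\sum_{i=1}^k a_i^e$ for $n\geq 1$. -}

module Defs where

open import Data.Nat using (ℕ; zero; suc; _+_; _^_; _/_; _%_)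
open import Data.List using (List; []; _∷_; map)
open import Data.Nat.ListAction using (sum)

-- Factoradic digits of m, starting at position i (i ≥ 1):
-- the digit at position i is m mod (i+1), and the remaining digits are those of
-- m div (i+1) starting at position i+1.  Standard "divide by 2, 3, 4, …" algorithm:
-- n = a₁·1! + a₂·2! + …  with 0 ≤ aᵢ ≤ i.
-- The fuel argument bounds the number of steps; fuel n suffices for n since
-- every step at least halves the value, and once the value is 0 we stop
-- (so the list carries no trailing zeros, i.e. a_k ≠ 0).
digitsFrom : (fuel : ℕ) → (i : ℕ) → (m : ℕ) → List ℕ
digitsFrom zero    i m       = []
digitsFrom (suc f) i zero    = []
digitsFrom (suc f) i (suc m) = (suc m % suc i) ∷ digitsFrom f (suc i) (suc m / suc i)

factoradicDigits : ℕ → List ℕ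
factoradicDigits n = digitsFrom n 1 n

S! : ℕ → ℕ → ℕ
S! e n = sum (map (λ a → a ^ e) (factoradicDigits n))

open import Data.Nat using (_<_)
open import Relation.Binary.PropositionalEquality using (_≡_)
open import Data.Product using (_×_)

InF : ℕ → ℕ → Set
InF e n = (1 < n) × (S! e n ≡ n)

{-# OPTIONS --safe #-}
-- Dividing by 2 is the first step of the factoradic algorithm, and 2k and 2k + 1 both
-- leave the quotient k, so they share every digit except a₁, which is 0 for 2k and 1
-- for 2k + 1.  Hence S_{e,!}(2k + 1) = S_{e,!}(2k) + 1 for e ≥ 1, and 2k is a fixed
-- point exactly when 2k + 1 is.
module Submission where

open import Defs
open import Data.Nat using (ℕ; zero; suc; _+_; _*_; _^_; _/_; _≤_; _∸_; _%_; z≤n; s≤s)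
open import Data.Nat.Properties using (≤-refl; ≤-trans; ≤-pred; n≤1+n; +-identityʳ; ^-zeroˡ; m≤m*n; suc-injective)
open import Data.Nat.DivMod using (m/n<m; m≡m%n+[m/n]*n; [m+kn]%n≡m%n; m*n%n≡0; m*n/n≡m; +-distrib-/-∣ʳ)
open import Data.Nat.Divisibility using (n∣m*n)
open import Data.List using (List; _∷_; map)
open import Data.Nat.ListAction using (sum)
open import Data.Product using (_×_; _,_)
open import Relation.Binary.PropositionalEquality using (_≡_; refl; sym; trans; cong; cong₂; subst; module ≡-Reasoning)

digitsFrom-fuel : ∀ {f g} i {m} → m ≤ f → m ≤ g → digitsFrom f (suc i) m ≡ digitsFrom g (suc i) m
digitsFrom-fuel {zero}  {zero}  i {zero}  _       _       = refl
digitsFrom-fuel {zero}  {suc g} i {zero}  _       _       = refl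
digitsFrom-fuel {suc f} {zero}  i {zero}  _       _       = refl
digitsFrom-fuel {suc f} {suc g} i {zero}  _       _       = refl
digitsFrom-fuel {suc f} {suc g} i {suc m} (s≤s m≤f) (s≤s m≤g) =
  cong (suc m % suc (suc i) ∷_) (digitsFrom-fuel (suc i) (≤-trans q≤m m≤f) (≤-trans q≤m m≤g))
  where
  q≤m : suc m / suc (suc i) ≤ m
  q≤m = ≤-pred (m/n<m (suc m) (suc (suc i)) (s≤s (s≤s z≤n)))

[1+k*2]/2≡k : ∀ k → suc (k * 2) / 2 ≡ k
[1+k*2]/2≡k k = trans (+-distrib-/-∣ʳ 1 {d = 2} (n∣m*n k)) (m*n/n≡m k 2)

factoradicDigits-odd : ∀ k → factoradicDigits (suc (k * 2)) ≡ 1 ∷ digitsFrom k 2 k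
factoradicDigits-odd k = cong₂ _∷_ ([m+kn]%n≡m%n 1 k 2) (begin
    digitsFrom (k * 2) 2 (suc (k * 2) / 2) ≡⟨ cong (digitsFrom (k * 2) 2) ([1+k*2]/2≡k k) ⟩
    digitsFrom (k * 2) 2 k                 ≡⟨ digitsFrom-fuel 1 (m≤m*n k 2) ≤-refl ⟩
    digitsFrom k 2 k                       ∎)
  where open ≡-Reasoning

factoradicDigits-even : ∀ k → factoradicDigits (suc k * 2) ≡ 0 ∷ digitsFrom (suc k) 2 (suc k)
factoradicDigits-even k = cong₂ _∷_ (m*n%n≡0 (suc k) 2) (begin
    digitsFrom (suc (k * 2)) 2 (suc k * 2 / 2) ≡⟨ cong (digitsFrom (suc (k * 2)) 2) (m*n/n≡m (suc k) 2) ⟩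
    digitsFrom (suc (k * 2)) 2 (suc k)         ≡⟨ digitsFrom-fuel 1 (s≤s (m≤m*n k 2)) ≤-refl ⟩
    digitsFrom (suc k) 2 (suc k)               ∎)
  where open ≡-Reasoning

S!-suc-double : ∀ {e} → 1 ≤ e → ∀ k → S! e (suc (k * 2)) ≡ suc (S! e (k * 2))
S!-suc-double {suc e} _ zero    = trans (+-identityʳ (1 ^ suc e)) (^-zeroˡ (suc e))
S!-suc-double {suc e} _ (suc k) = begin
    S! (suc e) (suc (suc k * 2))   ≡⟨ cong powerSum (factoradicDigits-odd (suc k)) ⟩
    1 ^ suc e + powerSum tail      ≡⟨ cong (_+ powerSum tail) (^-zeroˡ (suc e)) ⟩
    suc (powerSum tail)            ≡⟨ cong (λ ds → suc (powerSum ds)) (sym (factoradicDigits-even k)) ⟩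
    suc (S! (suc e) (suc k * 2))   ∎
  where
  open ≡-Reasoning
  powerSum : List ℕ → ℕ
  powerSum ds = sum (map (λ a → a ^ suc e) ds)
  tail : List ℕ
  tail = digitsFrom (suc k) 2 (suc k)

InF-double⇒InF-suc-double : ∀ {e} → 1 ≤ e → ∀ k → InF e (k * 2) → InF e (suc (k * 2))
InF-double⇒InF-suc-double e≥1 k (1<2k , fixed) =
  ≤-trans 1<2k (n≤1+n (k * 2)) , trans (S!-suc-double e≥1 k) (cong suc fixed)

InF-suc-double⇒InF-double : ∀ {e} → 1 ≤ e → ∀ k → InF e (suc (k * 2)) → InF e (k * 2)
InF-suc-double⇒InF-double _   zero    (s≤s () , _)
InF-suc-double⇒InF-double e≥1 (suc k) (_ , fixed) =
  s≤s (s≤s z≤n) , suc-injective (trans (sym (S!-suc-double e≥1 (suc k))) fixed)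

proposition2p2 : (e : ℕ) → 1 ≤ e → (n : ℕ) → InF e n →
    ((n % 2 ≡ 1 → InF e (n ∸ 1)) × (n % 2 ≡ 0 → InF e (suc n)))
proposition2p2 e e≥1 n n∈F = odd , even
  where
  n≡r+q*2 : n ≡ n % 2 + n / 2 * 2
  n≡r+q*2 = m≡m%n+[m/n]*n n 2

  odd : n % 2 ≡ 1 → InF e (n ∸ 1)
  odd n%2≡1 = subst (InF e) (sym (cong (_∸ 1) n≡1+q*2))
                (InF-suc-double⇒InF-double e≥1 (n / 2) (subst (InF e) n≡1+q*2 n∈F))
    where
    n≡1+q*2 : n ≡ suc (n / 2 * 2)
    n≡1+q*2 = trans n≡r+q*2 (cong (_+ n / 2 * 2) n%2≡1)

  even : n % 2 ≡ 0 → InF e (suc n)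
  even n%2≡0 = subst (InF e) (cong suc (sym n≡q*2))
                 (InF-double⇒InF-suc-double e≥1 (n / 2) (subst (InF e) n≡q*2 n∈F))
    where
    n≡q*2 : n ≡ n / 2 * 2
    n≡q*2 = trans n≡r+q*2 (cong (_+ n / 2 * 2) n%2≡0)
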